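{- Let $\Gamma=(V,H)$ be an oriented hypergraph with no vertex of degree zero and normalized Laplacian $L$. If there are $\hat n\geq 1$ vertices of $\Gamma$ that are pairwise duplicate vertices, then the multiplicity of $1$ as an eigenvalue of $L$ is at least $\hat n-1$.
   Context: An oriented hypergraph is a pair $\Gamma=(V,H)$ where $V$ is a finite vertex set and each hyperedge $h\in H$ is a pair $(h_{in},h_{out})$ of disjoint subsets of $V$; $h$ is identified with $h_{in}\cup h_{out}$. Two vertices of $h$ are co-oriented in $h$ if they lie in the same one of $h_{in},h_{out}$, anti-oriented otherwise. $\deg(i)$ is the number of hyperedges containing $i$; $D$ is the diagonal degree matrix. The adjacency matrix $A$ has $A_{ii}=0$ and, for $i\neq j$, $A_{ij}=\#\{h: i,j \text{ anti-oriented in } h\}-\#\{h: i,j\text{ co-oriented in } h\}$. The normalized Laplacian is $L=\mathrm{Id}-D^{ -1}A$, i.e. $Lf(i)=f(i)-\frac{1}{\deg(i)}\sum_{j\neq i}A_{ij}f(j)$ for $f:V\to\mathbb{R}$. Vertices $i,j$ are duplicate vertices if $A_{il}=A_{jl}$ for all $l\in V$. -}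

module Defs where

open import Data.Nat using (ℕ; zero; suc)
open import Data.Integer using (ℤ; +_; -[1+_])
open import Data.Fin using (Fin; zero; suc; _≟_)
open import Data.List using (List; []; _∷_)
open import Data.Rational using (ℚ; 0ℚ; _/_; _+_; _*_; _-_)
open import Relation.Nullary using (yes; no)
open import Relation.Binary.PropositionalEquality using (_≡_)
open import Data.Product using (Σ; _×_)

-- Incidence of a vertex in a hyperedge: in h_in, in h_out, or not in h.
-- Representing a hyperedge as a function V → Inc makes h_in and h_out
-- disjoint by construction.
data Inc : Set where
  inV outV none : Inc

Hyperedge : ℕ → Set
Hyperedge n = Fin n → Inc

record OHypergraph (n : ℕ) : Set where
  constructor mkOH
  field
    edges : List (Hyperedge n)
open OHypergraph public

sumFin : (m : ℕ) → (Fin m → ℚ) → ℚ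
sumFin zero    f = 0ℚ
sumFin (suc m) f = f zero + sumFin m (λ k → f (suc k))

inEdge : Inc → ℕ
inEdge none = 0
inEdge inV  = 1
inEdge outV = 1

deg : ∀ {n} → OHypergraph n → Fin n → ℕ
deg Γ i = go (edges Γ)
  where
  go : List (Hyperedge _) → ℕ
  go []      = 0
  go (h ∷ hs) = inEdge (h i) Data.Nat.+ go hs

-- contribution of one hyperedge to A_ij (i ≠ j):
-- +1 if anti-oriented, -1 if co-oriented, 0 if not both in h.
contrib : Inc → Inc → ℤ
contrib inV  inV  = -[1+ 0 ]
contrib outV outV = -[1+ 0 ]
contrib inV  outV = + 1
contrib outV inV  = + 1
contrib _    _    = + 0

adj : ∀ {n} → OHypergraph n → Fin n → Fin n → ℤ
adj Γ i j with i ≟ j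
... | yes _ = + 0
... | no  _ = go (edges Γ)
  where
  go : List (Hyperedge _) → ℤ
  go []       = + 0
  go (h ∷ hs) = contrib (h i) (h j) Data.Integer.+ go hs

-- 1/d as a rational, totalised by 1/0 := 0 (only used when deg ≠ 0).
invℕ : ℕ → ℚ
invℕ zero    = 0ℚ
invℕ (suc k) = + 1 / suc k

-- normalized Laplacian L = Id - D⁻¹A acting on f : V → ℚ:
-- (Lf)(i) = f(i) - (1/deg i) Σ_{j ≠ i} A_ij f(j)   (A_ii = 0)
laplacian : ∀ {n} → OHypergraph n → (Fin n → ℚ) → Fin n → ℚ
laplacian {n} Γ f i =
  f i - invℕ (deg Γ i) * sumFin n (λ j → (adj Γ i j / 1) * f j)

Duplicate : ∀ {n} → OHypergraph n → Fin n → Fin n → Set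
Duplicate {n} Γ i j = ∀ (l : Fin n) → adj Γ i l ≡ adj Γ j l

-- f is an eigenfunction of L for eigenvalue λ (f need not be nonzero here)
InEigenspace : ∀ {n} → OHypergraph n → ℚ → (Fin n → ℚ) → Set
InEigenspace Γ λ′ f = ∀ i → laplacian Γ f i ≡ λ′ * f i

LinIndep : ∀ {n} (m : ℕ) → (Fin m → Fin n → ℚ) → Set
LinIndep m v = ∀ (c : Fin m → ℚ) →
  (∀ i → sumFin m (λ k → c k * v k i) ≡ 0ℚ) → ∀ k → c k ≡ 0ℚ

-- multiplicity of λ as an eigenvalue of L is at least m:
-- the λ-eigenspace contains m linearly independent vectors.
MultAtLeast : ∀ {n} → OHypergraph n → ℚ → ℕ → Set
MultAtLeast {n} Γ λ′ m =
  Σ (Fin m → Fin n → ℚ) (λ v → LinIndep m v × (∀ k → InEigenspace Γ λ′ (v k)))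

-- Two duplicate vertices a, b have equal rows of the symmetric matrix A, hence
-- equal columns, so A (e_a − e_b) = 0 and L (e_a − e_b) = e_a − e_b.  For
-- pairwise duplicate vertices v₀, …, v_{n̂−1} the n̂ − 1 vectors e_{v_k} − e_{v₀}
-- (k ≥ 1) are linearly independent: evaluating a combination at v_k isolates
-- its k-th coefficient.
module Submission where

open import Defs
open import Data.Nat using (ℕ; _≥_; _∸_; NonZero)
open import Data.Fin using (Fin)
open import Data.Rational using (1ℚ)
open import Function.Definitions using (Injective)
open import Relation.Binary.PropositionalEquality using (_≡_)

open import Algebra.Bundles using (CommutativeRing)
open import Data.Nat using (zero; suc)
open import Data.Fin using (zero; suc; _≟_)
open import Data.Fin.Properties using (0≢1+n; suc-injective)
open import Data.Integer as ℤ using (ℤ)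
open import Data.List using (List; []; _∷_)
open import Data.Product using (_,_)
open import Data.Rational using (ℚ; 0ℚ; _+_; _*_; _-_; _/_)
open import Data.Rational.Properties
  using (+-*-commutativeRing; +-identityˡ; +-identityʳ; +-inverseʳ; *-identityʳ; *-zeroʳ)
open import Data.Rational.Solver using (module +-*-Solver)
open import Function using (_∘_)
open import Relation.Binary.PropositionalEquality using (_≢_; refl; sym; trans; cong; cong₂; module ≡-Reasoning)
open import Relation.Nullary using (Dec; yes; no; contradiction)

open import Algebra.Properties.Semiring.Sum (CommutativeRing.semiring +-*-commutativeRing)
  using (sum; sum-syntax; sum-cong-≗; sum-replicate-zero)
open import Algebra.Properties.Ring (CommutativeRing.ring +-*-commutativeRing)
  using (x[y-z]≈xy-xz)
open +-*-Solver
open ≡-Reasoning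

sumFin≡sum : ∀ m (f : Fin m → ℚ) → sumFin m f ≡ sum f
sumFin≡sum zero    f = refl
sumFin≡sum (suc m) f = cong (f zero +_) (sumFin≡sum m (f ∘ suc))

∑-distrib-− : ∀ {m} (f g : Fin m → ℚ) → ∑[ j < m ] (f j - g j) ≡ sum f - sum g
∑-distrib-− {zero}  f g = refl
∑-distrib-− {suc m} f g = begin
  (f zero - g zero) + ∑[ j < m ] (f (suc j) - g (suc j))
    ≡⟨ cong (f zero - g zero +_) (∑-distrib-− (f ∘ suc) (g ∘ suc)) ⟩
  (f zero - g zero) + (sum (f ∘ suc) - sum (g ∘ suc))
    ≡⟨ solve 4 (λ x y s t → (x :- y) :+ (s :- t) := (x :+ s) :- (y :+ t)) refl
         (f zero) (g zero) (sum (f ∘ suc)) (sum (g ∘ suc)) ⟩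
  sum f - sum g
    ∎

δ : ∀ {n} → Fin n → Fin n → ℚ
δ zero    zero    = 1ℚ
δ zero    (suc _) = 0ℚ
δ (suc _) zero    = 0ℚ
δ (suc a) (suc b) = δ a b

δ-refl : ∀ {n} (a : Fin n) → δ a a ≡ 1ℚ
δ-refl zero    = refl
δ-refl (suc a) = δ-refl a

δ-≢ : ∀ {n} {a b : Fin n} → a ≢ b → δ a b ≡ 0ℚ
δ-≢ {a = zero}  {zero}  a≢b = contradiction refl a≢b
δ-≢ {a = zero}  {suc b} a≢b = refl
δ-≢ {a = suc a} {zero}  a≢b = refl
δ-≢ {a = suc a} {suc b} a≢b = δ-≢ (a≢b ∘ cong suc)

δ-sym : ∀ {n} (a b : Fin n) → δ a b ≡ δ b a
δ-sym zero    zero    = refl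
δ-sym zero    (suc b) = refl
δ-sym (suc a) zero    = refl
δ-sym (suc a) (suc b) = δ-sym a b

δ-injective : ∀ {m n} {T : Fin m → Fin n} → Injective _≡_ _≡_ T →
              ∀ a b → δ (T a) (T b) ≡ δ a b
δ-injective {T = T} T-inj a b with a ≟ b
... | yes refl = trans (δ-refl (T a)) (sym (δ-refl a))
... | no  a≢b  = trans (δ-≢ (a≢b ∘ T-inj)) (sym (δ-≢ a≢b))

sum-δ : ∀ {m} (f : Fin m → ℚ) (a : Fin m) → ∑[ j < m ] (f j * δ a j) ≡ f a
sum-δ {suc m} f zero = begin
  f zero * 1ℚ + ∑[ j < m ] (f (suc j) * 0ℚ)
    ≡⟨ cong₂ _+_ (*-identityʳ (f zero)) (sum-cong-≗ (*-zeroʳ ∘ f ∘ suc)) ⟩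
  f zero + ∑[ j < m ] 0ℚ
    ≡⟨ cong (f zero +_) (sum-replicate-zero m) ⟩
  f zero + 0ℚ
    ≡⟨ +-identityʳ (f zero) ⟩
  f zero
    ∎
sum-δ {suc m} f (suc a) =
  trans (cong₂ _+_ (*-zeroʳ (f zero)) (sum-δ (f ∘ suc) a)) (+-identityˡ (f (suc a)))

δ-diff : ∀ {n} → Fin n → Fin n → Fin n → ℚ
δ-diff a b j = δ a j - δ b j

δ-diff-linIndep : ∀ {m n} {T : Fin m → Fin n} {b : Fin n} →
                  Injective _≡_ _≡_ T → (∀ k → T k ≢ b) →
                  LinIndep m (λ k → δ-diff (T k) b)
δ-diff-linIndep {m} {T = T} {b} T-inj T≢b c combination≡0 k = begin
  c k                                                  ≡⟨ sum-δ c k ⟨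
  ∑[ k′ < m ] (c k′ * δ k k′)                          ≡⟨ sum-cong-≗ (cong (c _ *_) ∘ coordinate) ⟨
  ∑[ k′ < m ] (c k′ * δ-diff (T k′) b (T k))           ≡⟨ sumFin≡sum m _ ⟨
  sumFin m (λ k′ → c k′ * δ-diff (T k′) b (T k))       ≡⟨ combination≡0 (T k) ⟩
  0ℚ                                                   ∎
  where
  coordinate : ∀ k′ → δ-diff (T k′) b (T k) ≡ δ k k′
  coordinate k′ = begin
    δ (T k′) (T k) - δ b (T k)  ≡⟨ cong₂ _-_ (δ-injective T-inj k′ k) (δ-≢ (T≢b k ∘ sym)) ⟩
    δ k′ k - 0ℚ                 ≡⟨ solve 1 (λ x → x :- con 0ℚ := x) refl (δ k′ k) ⟩
    δ k′ k                      ≡⟨ δ-sym k′ k ⟩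
    δ k k′                      ∎

contrib-sym : ∀ x y → contrib x y ≡ contrib y x
contrib-sym inV  inV  = refl
contrib-sym inV  outV = refl
contrib-sym inV  none = refl
contrib-sym outV inV  = refl
contrib-sym outV outV = refl
contrib-sym outV none = refl
contrib-sym none inV  = refl
contrib-sym none outV = refl
contrib-sym none none = refl

contribSum : ∀ {n} → List (Hyperedge n) → Fin n → Fin n → ℤ
contribSum []       i j = ℤ.+ 0
contribSum (h ∷ hs) i j = contrib (h i) (h j) ℤ.+ contribSum hs i j

contribSum-sym : ∀ {n} (hs : List (Hyperedge n)) i j → contribSum hs i j ≡ contribSum hs j i
contribSum-sym []       i j = refl
contribSum-sym (h ∷ hs) i j = cong₂ ℤ._+_ (contrib-sym (h i) (h j)) (contribSum-sym hs i j)

adj≡contribSum : ∀ {n} (hs : List (Hyperedge n)) {i j} → i ≢ j → adj (mkOH hs) i j ≡ contribSum hs i j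
adj≡contribSum []       {i} {j} i≢j with i ≟ j
... | yes i≡j = contradiction i≡j i≢j
... | no  _   = refl
adj≡contribSum (h ∷ hs) {i} {j} i≢j with i ≟ j | adj≡contribSum hs i≢j
... | yes i≡j | _  = contradiction i≡j i≢j
... | no  _   | ih = cong (λ s → contrib (h i) (h j) ℤ.+ s) ih

adj-sym : ∀ {n} (Γ : OHypergraph n) i j → adj Γ i j ≡ adj Γ j i
adj-sym Γ i j = by-cases (i ≟ j)
  where
  by-cases : Dec (i ≡ j) → adj Γ i j ≡ adj Γ j i
  by-cases (yes refl) = refl
  by-cases (no  i≢j)  = begin
    adj Γ i j                ≡⟨ adj≡contribSum (edges Γ) i≢j ⟩
    contribSum (edges Γ) i j ≡⟨ contribSum-sym (edges Γ) i j ⟩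
    contribSum (edges Γ) j i ≡⟨ adj≡contribSum (edges Γ) (i≢j ∘ sym) ⟨
    adj Γ j i                ∎

duplicate-column : ∀ {n} (Γ : OHypergraph n) {a b} → Duplicate Γ a b → ∀ i → adj Γ i a ≡ adj Γ i b
duplicate-column Γ {a} {b} dup i = begin
  adj Γ i a  ≡⟨ adj-sym Γ i a ⟩
  adj Γ a i  ≡⟨ dup i ⟩
  adj Γ b i  ≡⟨ adj-sym Γ b i ⟩
  adj Γ i b  ∎

AdjKernel : ∀ {n} → OHypergraph n → (Fin n → ℚ) → Set
AdjKernel {n} Γ f = ∀ i → sumFin n (λ j → (adj Γ i j / 1) * f j) ≡ 0ℚ

-- The factor 1/deg multiplies 0, so no degree hypothesis is needed (corollary1
-- ignores its NonZero assumption).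
AdjKernel⇒InEigenspace-1 : ∀ {n} (Γ : OHypergraph n) {f} → AdjKernel Γ f → InEigenspace Γ 1ℚ f
AdjKernel⇒InEigenspace-1 {n} Γ {f} Af≡0 i = begin
  f i - invℕ (deg Γ i) * sumFin n (λ j → (adj Γ i j / 1) * f j)
    ≡⟨ cong (λ s → f i - invℕ (deg Γ i) * s) (Af≡0 i) ⟩
  f i - invℕ (deg Γ i) * 0ℚ
    ≡⟨ solve 2 (λ x d → x :- d :* con 0ℚ := con 1ℚ :* x) refl (f i) (invℕ (deg Γ i)) ⟩
  1ℚ * f i
    ∎

δ-diff∈AdjKernel : ∀ {n} (Γ : OHypergraph n) {a b} → Duplicate Γ a b → AdjKernel Γ (δ-diff a b)
δ-diff∈AdjKernel {n} Γ {a} {b} dup i = begin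
  sumFin n (λ j → A j * δ-diff a b j)
    ≡⟨ sumFin≡sum n _ ⟩
  ∑[ j < n ] (A j * (δ a j - δ b j))
    ≡⟨ sum-cong-≗ (λ j → x[y-z]≈xy-xz (A j) (δ a j) (δ b j)) ⟩
  ∑[ j < n ] (A j * δ a j - A j * δ b j)
    ≡⟨ ∑-distrib-− (λ j → A j * δ a j) (λ j → A j * δ b j) ⟩
  ∑[ j < n ] (A j * δ a j) - ∑[ j < n ] (A j * δ b j)
    ≡⟨ cong₂ _-_ (sum-δ A a) (sum-δ A b) ⟩
  A a - A b
    ≡⟨ cong (λ z → z / 1 - A b) (duplicate-column Γ dup i) ⟩
  A b - A b
    ≡⟨ +-inverseʳ (A b) ⟩
  0ℚ
    ∎
  where
  A : Fin n → ℚ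
  A j = adj Γ i j / 1

corollary1 : ∀ {n : ℕ} (Γ : OHypergraph n) →
    (∀ (i : Fin n) → NonZero (deg Γ i)) →
    (n̂ : ℕ) → n̂ ≥ 1 →
    (S : Fin n̂ → Fin n) → Injective _≡_ _≡_ S →
    (∀ (a b : Fin n̂) → Duplicate Γ (S a) (S b)) →
    MultAtLeast Γ 1ℚ (n̂ ∸ 1)
corollary1 Γ _ (suc m) _ S S-inj dup =
    (λ k → δ-diff (S (suc k)) (S zero))
  , δ-diff-linIndep (suc-injective ∘ S-inj) (λ k → 0≢1+n ∘ sym ∘ S-inj)
  , λ k → AdjKernel⇒InEigenspace-1 Γ (δ-diff∈AdjKernel Γ {S (suc k)} {S zero} (dup (suc k) zero))
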